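{- Let $(S_1,S_2)$ be a two-sorted set. Set up the following data: - $FS_i$ is the free MV-algebra on $S_i$, with insertion of generators $\iota_{S_i}$, for $i=1,2$; - $\upsilon_{FS_1}\colon FS_1\to\Upsilon FS_1$ is the universal state of $FS_1$; - $\Upsilon FS_1+FS_2$ is the coproduct in the category of MV-algebras and their homomorphisms, with coproduct injections $\mathrm{in}_1\colon\Upsilon FS_1\to\Upsilon FS_1+FS_2$ and $\mathrm{in}_2\colon FS_2\to\Upsilon FS_1+FS_2$. Then the object $(FS_1,\ \Upsilon FS_1+FS_2)$ of $\mathsf{P}$ with operation $s=\mathrm{in}_1\circ\upsilon_{FS_1}$, together with the two-sorted function $\eta=(\iota_{S_1},\ \mathrm{in}_2\circ\iota_{S_2})$, is the free state generated by $(S_1,S_2)$.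
   Context: In an MV-algebra, $a\odot b=\neg(\neg a\oplus\neg b)$ and $1=\neg0$. For an MV-algebra $N$, $\Xi N$ is its unital Abelian $\ell$-group under Mundici's equivalence, with $N$ identified with the unit interval of $\Xi N$. A state of MV-algebras $s\colon M\to N$ is a map with $s(1)=1$ and $s(a\oplus b)=s(a)+s(b)$ (in $\Xi N$) whenever $a\odot b=0$. A universal state of $M$ is a state $\upsilon_M\colon M\to\Upsilon M$ such that every state $t\colon M\to N$ equals $h\circ\upsilon_M$ for exactly one MV-homomorphism $h$; universal states exist for all MV-algebras. $\mathsf{P}$ is the category whose objects are pairs of MV-algebras $(M,N)$ equipped with a state $s\colon M\to N$. Its morphisms $(M_1,N_1)\to(M_2,N_2)$ are pairs of MV-homomorphisms $(m,n)$ with $n\circ s_1=s_2\circ m$. The free state generated by a pair of sets $(S_1,S_2)$ is an object $(A,B)$ of $\mathsf{P}$ with a pair of functions $\eta\colon(S_1,S_2)\to(A,B)$ such that every pair of functions $f\colon(S_1,S_2)\to(M,N)$ into an object of $\mathsf{P}$ equals $h\circ\eta$ for exactly one morphism $h$ of $\mathsf{P}$. -}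

module Defs where

open import Level using (Level; _⊔_) renaming (suc to lsuc)
open import Data.Product using (Σ; _×_; _,_; ∃)
open import Relation.Binary using (IsEquivalence)

record MVAlgebra (c ℓ : Level) : Set (lsuc (c ⊔ ℓ)) where
  infix  4 _≈_
  infixl 6 _⊕_ _⊙_
  field
    Carrier : Set c
    _≈_     : Carrier → Carrier → Set ℓ
    _⊕_     : Carrier → Carrier → Carrier
    ¬_      : Carrier → Carrier
    𝟘       : Carrier
    isEquivalence : IsEquivalence _≈_
    ⊕-cong  : ∀ {x y u v} → x ≈ y → u ≈ v → (x ⊕ u) ≈ (y ⊕ v)
    ¬-cong  : ∀ {x y} → x ≈ y → (¬ x) ≈ (¬ y)
    ⊕-assoc : ∀ x y z → ((x ⊕ y) ⊕ z) ≈ (x ⊕ (y ⊕ z))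
    ⊕-comm  : ∀ x y → (x ⊕ y) ≈ (y ⊕ x)
    ⊕-identityʳ : ∀ x → (x ⊕ 𝟘) ≈ x
    ¬-involutive : ∀ x → (¬ (¬ x)) ≈ x
    ⊕-absorb : ∀ x → (x ⊕ (¬ 𝟘)) ≈ (¬ 𝟘)
    łukasiewicz : ∀ x y → ((¬ ((¬ x) ⊕ y)) ⊕ y) ≈ ((¬ ((¬ y) ⊕ x)) ⊕ x)

  _⊙_ : Carrier → Carrier → Carrier
  a ⊙ b = ¬ ((¬ a) ⊕ (¬ b))

  𝟙 : Carrier
  𝟙 = ¬ 𝟘

open MVAlgebra public using (Carrier)

module _ {c ℓ : Level} where

  record Hom (M N : MVAlgebra c ℓ) : Set (c ⊔ ℓ) where
    private
      module M = MVAlgebra M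
      module N = MVAlgebra N
    field
      fun     : M.Carrier → N.Carrier
      fun-cong : ∀ {x y} → x M.≈ y → fun x N.≈ fun y
      pres-⊕  : ∀ x y → fun (x M.⊕ y) N.≈ (fun x N.⊕ fun y)
      pres-¬  : ∀ x → fun (M.¬ x) N.≈ (N.¬ (fun x))
      pres-𝟘  : fun M.𝟘 N.≈ N.𝟘

  open Hom public

  PtwEq : {A : Set c} (N : MVAlgebra c ℓ) → (A → Carrier N) → (A → Carrier N) → Set (c ⊔ ℓ)
  PtwEq {A} N f g = ∀ (a : A) → MVAlgebra._≈_ N (f a) (g a)

  syntax PtwEq N f g = f ≗[ N ] g

  ∃!Hom : (M N : MVAlgebra c ℓ) → (Hom M N → Set (c ⊔ ℓ)) → Set (c ⊔ ℓ)
  ∃!Hom M N P = Σ (Hom M N) λ h → P h × (∀ (h' : Hom M N) → P h' → fun h' ≗[ N ] fun h)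

  IsFreeMV : (S : Set c) (F : MVAlgebra c ℓ) → (S → Carrier F) → Set (lsuc (c ⊔ ℓ))
  IsFreeMV S F ι = ∀ (M : MVAlgebra c ℓ) (f : S → Carrier M) →
    ∃!Hom F M (λ h → (λ x → fun h (ι x)) ≗[ M ] f)

  IsCoproduct : (A B C : MVAlgebra c ℓ) → Hom A C → Hom B C → Set (lsuc (c ⊔ ℓ))
  IsCoproduct A B C in₁ in₂ = ∀ (D : MVAlgebra c ℓ) (f : Hom A D) (g : Hom B D) →
    ∃!Hom C D (λ h → ((λ x → fun h (fun in₁ x)) ≗[ D ] fun f)
                   × ((λ y → fun h (fun in₂ y)) ≗[ D ] fun g))

  -- The condition "s(a ⊕ b) = s(a) + s(b) in ΞN" is
  -- expressed intrinsically: for x, y in the unit interval [0,1] of ΞN,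
  -- x + y is (in [0,1] and) equal to z iff  x ⊙ y = 0  and  z = x ⊕ y.
  IsState : (M N : MVAlgebra c ℓ) → (Carrier M → Carrier N) → Set (c ⊔ ℓ)
  IsState M N s =
      (∀ {x y} → x M.≈ y → s x N.≈ s y)
    × (s M.𝟙 N.≈ N.𝟙)
    × (∀ a b → (a M.⊙ b) M.≈ M.𝟘 →
         ((s a N.⊙ s b) N.≈ N.𝟘) × (s (a M.⊕ b) N.≈ (s a N.⊕ s b)))
    where
      module M = MVAlgebra M
      module N = MVAlgebra N

  IsUniversalState : (M U : MVAlgebra c ℓ) → (Carrier M → Carrier U) → Set (lsuc (c ⊔ ℓ))
  IsUniversalState M U υ = IsState M U υ ×
    (∀ (N : MVAlgebra c ℓ) (t : Carrier M → Carrier N) → IsState M N t →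
       ∃!Hom U N (λ h → (λ x → fun h (υ x)) ≗[ N ] t))

  record PObj : Set (lsuc (c ⊔ ℓ)) where
    field
      M₁ M₂   : MVAlgebra c ℓ
      st      : Carrier M₁ → Carrier M₂
      isState : IsState M₁ M₂ st

  record PMor (X Y : PObj) : Set (c ⊔ ℓ) where
    private
      module X = PObj X
      module Y = PObj Y
    field
      m : Hom X.M₁ Y.M₁
      n : Hom X.M₂ Y.M₂
      commutes : (λ a → fun n (X.st a)) ≗[ Y.M₂ ] (λ a → Y.st (fun m a))

  FreeStateTriangles : {S₁ S₂ : Set c} (X Y : PObj) →
    (S₁ → Carrier (PObj.M₁ X)) → (S₂ → Carrier (PObj.M₂ X)) →
    (S₁ → Carrier (PObj.M₁ Y)) → (S₂ → Carrier (PObj.M₂ Y)) → PMor X Y → Set (c ⊔ ℓ)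
  FreeStateTriangles X Y η₁ η₂ f₁ f₂ h =
      ((λ x → fun (PMor.m h) (η₁ x)) ≗[ PObj.M₁ Y ] f₁)
    × ((λ y → fun (PMor.n h) (η₂ y)) ≗[ PObj.M₂ Y ] f₂)

  IsFreeState : (S₁ S₂ : Set c) (X : PObj) →
    (S₁ → Carrier (PObj.M₁ X)) → (S₂ → Carrier (PObj.M₂ X)) → Set (lsuc (c ⊔ ℓ))
  IsFreeState S₁ S₂ X η₁ η₂ =
    ∀ (Y : PObj) (f₁ : S₁ → Carrier (PObj.M₁ Y)) (f₂ : S₂ → Carrier (PObj.M₂ Y)) →
      Σ (PMor X Y) λ h →
        FreeStateTriangles X Y η₁ η₂ f₁ f₂ h
        × (∀ (h' : PMor X Y) → FreeStateTriangles X Y η₁ η₂ f₁ f₂ h' →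
             (fun (PMor.m h') ≗[ PObj.M₁ Y ] fun (PMor.m h))
           × (fun (PMor.n h') ≗[ PObj.M₂ Y ] fun (PMor.n h)))

  mkPObj : (M N : MVAlgebra c ℓ) (s : Carrier M → Carrier N) → IsState M N s → PObj
  mkPObj M N s p = record { M₁ = M ; M₂ = N ; st = s ; isState = p }

{-# OPTIONS --safe #-}
-- The free state is the composite of two free constructions. Free MV-algebras
-- turn (S₁ , S₂) into the pair (FS₁ , FS₂); then (M , B) ↦ (M , ΥM + B) with
-- state in₁ ∘ υ is free over pairs of MV-algebras: a homomorphism out of
-- ΥM + B is a homomorphism on B plus one on ΥM, and compatibility with a
-- given m on M forces the latter to be the one induced by the state st ∘ m.
module Submission where

open import Defs
open import Level using (Level)
open import Data.Product using (Σ; _,_; _×_; proj₁)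
open import Relation.Binary using (IsEquivalence)

private
  module Eq {c ℓ : Level} (M : MVAlgebra c ℓ) = IsEquivalence (MVAlgebra.isEquivalence M)

module _ {c ℓ : Level} where

  infixr 9 _∘ʰ_

  _∘ʰ_ : {A B D : MVAlgebra c ℓ} → Hom B D → Hom A B → Hom A D
  _∘ʰ_ {D = D} g f = record
    { fun      = λ x → fun g (fun f x)
    ; fun-cong = λ e → fun-cong g (fun-cong f e)
    ; pres-⊕   = λ x y → Eq.trans D (fun-cong g (pres-⊕ f x y)) (pres-⊕ g _ _)
    ; pres-¬   = λ x → Eq.trans D (fun-cong g (pres-¬ f x)) (pres-¬ g _)
    ; pres-𝟘   = Eq.trans D (fun-cong g (pres-𝟘 f)) (pres-𝟘 g)
    }

  pres-⊙ : {A B : MVAlgebra c ℓ} (h : Hom A B) → ∀ x y →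
    MVAlgebra._≈_ B (fun h (MVAlgebra._⊙_ A x y)) (MVAlgebra._⊙_ B (fun h x) (fun h y))
  pres-⊙ {B = B} h x y =
    Eq.trans B (pres-¬ h _)
      (MVAlgebra.¬-cong B
        (Eq.trans B (pres-⊕ h _ _) (MVAlgebra.⊕-cong B (pres-¬ h x) (pres-¬ h y))))

  pres-𝟙 : {A B : MVAlgebra c ℓ} (h : Hom A B) →
    MVAlgebra._≈_ B (fun h (MVAlgebra.𝟙 A)) (MVAlgebra.𝟙 B)
  pres-𝟙 {B = B} h = Eq.trans B (pres-¬ h _) (MVAlgebra.¬-cong B (pres-𝟘 h))

  hom∘state-isState : {M N P : MVAlgebra c ℓ} (h : Hom N P) (s : Carrier M → Carrier N) →
    IsState M N s → IsState M P (λ a → fun h (s a))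
  hom∘state-isState {P = P} h s (s-cong , s-𝟙 , s-additive) =
      (λ e → fun-cong h (s-cong e))
    , Eq.trans P (fun-cong h s-𝟙) (pres-𝟙 h)
    , λ a b a⊙b≈𝟘 →
        let (s-⊙ , s-⊕) = s-additive a b a⊙b≈𝟘
        in Eq.trans P (Eq.sym P (pres-⊙ h _ _)) (Eq.trans P (fun-cong h s-⊙) (pres-𝟘 h))
         , Eq.trans P (fun-cong h s-⊕) (pres-⊕ h _ _)

  state∘hom-isState : {L M N : MVAlgebra c ℓ} (h : Hom L M) (s : Carrier M → Carrier N) →
    IsState M N s → IsState L N (λ a → s (fun h a))
  state∘hom-isState {M = M} {N = N} h s (s-cong , s-𝟙 , s-additive) =
      (λ e → s-cong (fun-cong h e))
    , Eq.trans N (s-cong (pres-𝟙 h)) s-𝟙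
    , λ a b a⊙b≈𝟘 →
        let ha⊙hb≈𝟘 = Eq.trans M (Eq.sym M (pres-⊙ h a b))
                        (Eq.trans M (fun-cong h a⊙b≈𝟘) (pres-𝟘 h))
            (s-⊙ , s-⊕) = s-additive (fun h a) (fun h b) ha⊙hb≈𝟘
        in s-⊙ , Eq.trans N (s-cong (pres-⊕ h a b)) s-⊕

  coproductState-universal : (M U B C : MVAlgebra c ℓ) (υ : Carrier M → Carrier U) →
    IsUniversalState M U υ →
    (in₁ : Hom U C) (in₂ : Hom B C) → IsCoproduct U B C in₁ in₂ →
    (Y : PObj) (m : Hom M (PObj.M₁ Y)) (k : Hom B (PObj.M₂ Y)) →
    ∃!Hom C (PObj.M₂ Y) λ n →
        ((λ a → fun n (fun in₁ (υ a))) ≗[ PObj.M₂ Y ] (λ a → PObj.st Y (fun m a)))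
      × ((λ b → fun n (fun in₂ b)) ≗[ PObj.M₂ Y ] fun k)
  coproductState-universal M U B C υ (_ , υ-universal) in₁ in₂ coproduct Y m k =
    let open PObj Y using (M₂; st; isState)
        (g , g∘υ≈st∘m , g-unique) =
          υ-universal M₂ (λ a → st (fun m a)) (state∘hom-isState {N = M₂} m st isState)
        (n , (n∘in₁≈g , n∘in₂≈k) , n-unique) = coproduct M₂ g k
    in n
     , ((λ a → Eq.trans M₂ (n∘in₁≈g (υ a)) (g∘υ≈st∘m a)) , n∘in₂≈k)
     , λ n' (n'∘in₁∘υ≈st∘m , n'∘in₂≈k) →
         n-unique n' (g-unique (n' ∘ʰ in₁) n'∘in₁∘υ≈st∘m , n'∘in₂≈k)

theorem4p5 : {c ℓ : Level} (S₁ S₂ : Set c)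
    (FS₁ FS₂ : MVAlgebra c ℓ) (ι₁ : S₁ → Carrier FS₁) (ι₂ : S₂ → Carrier FS₂) →
    IsFreeMV S₁ FS₁ ι₁ → IsFreeMV S₂ FS₂ ι₂ →
    (ΥFS₁ : MVAlgebra c ℓ) (υ : Carrier FS₁ → Carrier ΥFS₁) →
    IsUniversalState FS₁ ΥFS₁ υ →
    (C : MVAlgebra c ℓ) (in₁ : Hom ΥFS₁ C) (in₂ : Hom FS₂ C) →
    IsCoproduct ΥFS₁ FS₂ C in₁ in₂ →
    Σ (IsState FS₁ C (λ a → fun in₁ (υ a))) λ isSt →
    IsFreeState S₁ S₂ (mkPObj FS₁ C (λ a → fun in₁ (υ a)) isSt) ι₁ (λ y → fun in₂ (ι₂ y))
theorem4p5 S₁ S₂ FS₁ FS₂ ι₁ ι₂ free₁ free₂ Υ υ universal C in₁ in₂ coproduct =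
  hom∘state-isState {M = FS₁} in₁ υ (proj₁ universal) , λ Y f₁ f₂ →
    let open PObj Y using (M₁; M₂; isState)
        (m , m∘ι₁≈f₁ , m-unique) = free₁ M₁ f₁
        (k , k∘ι₂≈f₂ , k-unique) = free₂ M₂ f₂
        (n , (commutes , n∘in₂≈k) , n-unique) =
          coproductState-universal FS₁ Υ FS₂ C υ universal in₁ in₂ coproduct Y m k
    in record { m = m ; n = n ; commutes = commutes }
     , (m∘ι₁≈f₁ , λ y → Eq.trans M₂ (n∘in₂≈k (ι₂ y)) (k∘ι₂≈f₂ y))
     , λ h' (m'∘ι₁≈f₁ , n'∘in₂∘ι₂≈f₂) →
         let open PMor h' renaming (m to m'; n to n'; commutes to commutes')
             m'≈m = m-unique m' m'∘ι₁≈f₁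
         in m'≈m
          , n-unique n' ( (λ a → Eq.trans M₂ (commutes' a) (proj₁ isState (m'≈m a)))
                        , k-unique (n' ∘ʰ in₂) n'∘in₂∘ι₂≈f₂)
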